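{- For every $n\ge1$ and every partition $\lambda\vdash n$, \[ \operatorname{deg}(\lambda)\ge \sigma(\lambda)(\sigma(\lambda)-1), \] where $\operatorname{deg}(\lambda)$ is the degree of $\lambda$ as a vertex of $G_n$.
   Context: $G_n$ is the partition graph: its vertices are the partitions of $n$, and two distinct partitions $\lambda\neq\mu$ are adjacent when $\mu$ is obtained from $\lambda$ by moving one cell from one part (of size $x$, the part shrinking to $x-1$ and disappearing if $x=1$) to another part or to a new part of size $1$, followed by reordering the parts in weakly decreasing order. $\sigma(\lambda)$ denotes the number of distinct part sizes of $\lambda$. -}

module Defs where

open import Relation.Nullary using (Dec)
open import Data.Nat using (ℕ; zero; suc; _≤_; _≥_; _<_; _∸_; _*_; _≤ᵇ_)
open import Data.Nat.Properties using (_≟_)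
open import Data.Product using (_×_; _,_; proj₁; proj₂)
open import Data.Bool using (if_then_else_)
open import Data.Nat.ListAction using (sum)
open import Data.List using (List; []; _∷_; length; filter; deduplicate; concatMap; _++_; map)
open import Data.List.Relation.Unary.All using (All)
open import Data.List.Relation.Unary.Linked using (Linked)
open import Data.List.Properties using (≡-dec)
open import Relation.Nullary using (¬?)
open import Relation.Binary.PropositionalEquality using (_≡_)

record IsPartition (n : ℕ) (λs : List ℕ) : Set where
  field
    decreasing : Linked _≥_ λs
    positive   : All (λ x → 1 ≤ x) λs
    sums       : sum λs ≡ n

_≟L_ : (xs ys : List ℕ) → Dec (xs ≡ ys)
_≟L_ = ≡-dec _≟_

insertDec : ℕ → List ℕ → List ℕ
insertDec x [] = x ∷ []
insertDec x (y ∷ ys) = if y ≤ᵇ x then x ∷ y ∷ ys else y ∷ insertDec x ys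

sortDec : List ℕ → List ℕ
sortDec [] = []
sortDec (x ∷ xs) = insertDec x (sortDec xs)

bumpOne : List ℕ → List (List ℕ)
bumpOne [] = []
bumpOne (y ∷ ys) = (suc y ∷ ys) ∷ map (y ∷_) (bumpOne ys)

shrinkOnto : ℕ → List ℕ → List ℕ
shrinkOnto zero    ys = ys
shrinkOnto (suc zero) ys = ys
shrinkOnto (suc (suc k)) ys = suc k ∷ ys

-- moves taking a cell from a part x, where `rest` are the other parts:
-- the cell goes to another part (one of `rest`) or to a new part of size 1
movesFrom : ℕ → List ℕ → List (List ℕ)
movesFrom x rest = map (shrinkOnto x) (bumpOne rest) ++ (shrinkOnto x (1 ∷ rest) ∷ [])

picks : List ℕ → List (ℕ × List ℕ)
picks [] = []
picks (x ∷ xs) = (x , xs) ∷ map (λ p → proj₁ p , x ∷ proj₂ p) (picks xs)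

allMoves : List ℕ → List (List ℕ)
allMoves λs = concatMap (λ p → movesFrom (proj₁ p) (proj₂ p)) (picks λs)

-- the distinct neighbours of λ in G_n: reorder results, drop λ itself, dedupe
neighbours : List ℕ → List (List ℕ)
neighbours λs = deduplicate _≟L_ (filter (λ μ → ¬? (μ ≟L λs)) (map sortDec (allMoves λs)))

deg : List ℕ → ℕ
deg λs = length (neighbours λs)

σ : List ℕ → ℕ
σ λs = length (deduplicate _≟_ λs)

{-# OPTIONS --safe #-}
-- Let S be the set of part sizes, s = |S| = σ(λ). Each ordered pair (x, y) of
-- distinct sizes yields a neighbour: move a cell from a part of size x to one of
-- size y, or to a new part when x = y + 1 (then x → y would give λ back). The
-- multiplicities that drop are exactly those of x and y (of x alone for a new
-- part), and the gain at y + 1 tells (x, y) from (y, x), so distinct pairs give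
-- distinct neighbours. Letting the pairs (x, x) stand for the sizes themselves,
-- this is an injection S × S → S ⊎ neighbours, whence s² ≤ s + deg λ.
module Submission where

open import Defs
open import Data.Nat using (ℕ; _≤_; _≥_; _*_; _∸_)
open import Data.List using (List)

open import Data.Nat using (zero; suc; pred; _+_; _<_; z≤n; s≤s; _≤ᵇ_)
open import Data.Nat.Properties
open import Algebra.Properties.CommutativeSemigroup +-commutativeSemigroup
  using (interchange; x∙yz≈y∙xz; xy∙z≈zy∙x)
open import Data.Bool using (true; false)
open import Data.Product using (_×_; _,_; proj₁; proj₂; ∃-syntax)
open import Data.Sum using (_⊎_; inj₁; inj₂)
import Data.Sum.Properties as Sum
open import Data.List using ([]; _∷_; [_]; length; filter; map; _++_; deduplicate; cartesianProduct)
open import Data.List.Properties using (length-map; length-++; map-++; filter-notAll)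
open import Data.List.Membership.Propositional using (_∈_)
open import Data.List.Membership.Propositional.Properties
  using (∈-map⁺; ∈-++⁺ˡ; ∈-++⁺ʳ; ∈-filter⁺; ∈-concatMap⁺; ∈-deduplicate⁺; ∈-deduplicate⁻; ∈-cartesianProduct⁻)
open import Data.List.Relation.Unary.Any using (here; there)
import Data.List.Relation.Unary.Any as Any
open import Data.List.Relation.Unary.All using (All)
import Data.List.Relation.Unary.All as All
open import Data.List.Relation.Unary.AllPairs using (_∷_)
open import Data.List.Relation.Unary.Unique.Propositional using (Unique)
open import Data.List.Relation.Unary.Unique.DecPropositional.Properties _≟_ using (deduplicate-!; cartesianProduct⁺)
open import Relation.Nullary using (Dec; yes; no; ¬?; contradiction)
open import Relation.Binary.Definitions using (DecidableEquality)
open import Relation.Binary.PropositionalEquality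
  using (_≡_; _≢_; ≢-sym; refl; sym; trans; cong; cong₂; subst; module ≡-Reasoning)

variable
  λs μ rest b : List ℕ
  x y x′ y′ : ℕ

δ : ℕ → ℕ → ℕ
δ v a with v ≟ a
... | yes _ = 1
... | no  _ = 0

δ-refl : ∀ v → δ v v ≡ 1
δ-refl v with v ≟ v
... | yes _  = refl
... | no v≢v = contradiction refl v≢v

δ-≢ : ∀ {v a} → v ≢ a → δ v a ≡ 0
δ-≢ {v} {a} v≢a with v ≟ a
... | yes v≡a = contradiction v≡a v≢a
... | no  _   = refl

mult : ℕ → List ℕ → ℕ
mult v []       = 0
mult v (a ∷ as) = δ v a + mult v as

∈⇒0<mult : ∀ {v as} → v ∈ as → 0 < mult v as
∈⇒0<mult {v} (here refl) rewrite δ-refl v = s≤s z≤n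
∈⇒0<mult {v} {a ∷ _} (there v∈) = <-≤-trans (∈⇒0<mult v∈) (m≤n+m _ (δ v a))

0<mult⇒∈ : ∀ {v} as → 0 < mult v as → v ∈ as
0<mult⇒∈ {v} (a ∷ as) 0<m with v ≟ a
... | yes refl = here refl
... | no  _    = there (0<mult⇒∈ as 0<m)

mult-insertDec : ∀ v a as → mult v (insertDec a as) ≡ δ v a + mult v as
mult-insertDec v a []       = refl
mult-insertDec v a (c ∷ cs) with c ≤ᵇ a
... | true  = refl
... | false = trans (cong (δ v c +_) (mult-insertDec v a cs)) (x∙yz≈y∙xz (δ v c) (δ v a) (mult v cs))

mult-sortDec : ∀ v as → mult v (sortDec as) ≡ mult v as
mult-sortDec v []       = refl
mult-sortDec v (a ∷ as) = trans (mult-insertDec v a (sortDec as)) (cong (δ v a +_) (mult-sortDec v as))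

mult-shrinkOnto : ∀ {v} → 1 ≤ v → ∀ a as → mult v (shrinkOnto a as) ≡ δ v (pred a) + mult v as
mult-shrinkOnto {suc _} _ zero          as = refl
mult-shrinkOnto {suc _} _ (suc zero)    as = refl
mult-shrinkOnto         _ (suc (suc a)) as = refl

mult-picks : x ∈ λs → ∃[ rest ] (x , rest) ∈ picks λs × (∀ v → mult v λs ≡ δ v x + mult v rest)
mult-picks {λs = a ∷ as} (here refl) = as , here refl , λ v → refl
mult-picks {x} {a ∷ as} (there x∈) with rest , picked , split ← mult-picks x∈ =
  a ∷ rest , there (∈-map⁺ _ picked) ,
  λ v → trans (cong (δ v a +_) (split v)) (x∙yz≈y∙xz (δ v a) (δ v x) (mult v rest))

-- y = 0 stands for a new part.
Grows : List ℕ → ℕ → List ℕ → Set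
Grows rest y b = ∀ {v} → 1 ≤ v → mult v b + δ v y ≡ mult v rest + δ v (suc y)

bumpOne-grows : y ∈ rest → ∃[ b ] b ∈ bumpOne rest × Grows rest y b
bumpOne-grows {rest = a ∷ as} (here refl) =
  suc a ∷ as , here refl , λ {v} _ → xy∙z≈zy∙x (δ v (suc a)) (mult v as) (δ v a)
bumpOne-grows {y} {a ∷ as} (there y∈) with b , bumped , grows ← bumpOne-grows y∈ =
  a ∷ b , there (∈-map⁺ _ bumped) , λ {v} v>0 → begin
    δ v a + mult v b + δ v y           ≡⟨ +-assoc (δ v a) _ _ ⟩
    δ v a + (mult v b + δ v y)         ≡⟨ cong (δ v a +_) (grows v>0) ⟩
    δ v a + (mult v as + δ v (suc y))  ≡⟨ +-assoc (δ v a) _ _ ⟨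
    δ v a + mult v as + δ v (suc y)    ∎
  where open ≡-Reasoning

newPart-grows : Grows rest 0 (1 ∷ rest)
newPart-grows {rest} {v} v>0 = begin
  δ v 1 + mult v rest + δ v 0  ≡⟨ cong (δ v 1 + mult v rest +_) (δ-≢ (n>0⇒n≢0 v>0)) ⟩
  δ v 1 + mult v rest + 0      ≡⟨ +-identityʳ _ ⟩
  δ v 1 + mult v rest          ≡⟨ +-comm (δ v 1) _ ⟩
  mult v rest + δ v 1          ∎
  where open ≡-Reasoning

∈-remainder : (∀ v → mult v λs ≡ δ v x + mult v rest) → y ∈ λs → y ≢ x → y ∈ rest
∈-remainder {x = x} {rest} {y} split y∈ y≢x =
  0<mult⇒∈ rest (subst (0 <_) (trans (split y) (cong (_+ mult y rest) (δ-≢ y≢x))) (∈⇒0<mult y∈))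

-- μ arises from λs by moving a cell from a part of size x to a part of size y,
-- where y = 0 stands for a new part. Size 0 is not counted, so a part of size 1
-- that loses its cell simply disappears.
record Move (λs : List ℕ) (x y : ℕ) (μ : List ℕ) : Set where
  constructor move
  field
    balance : ∀ {v} → 1 ≤ v →
              mult v μ + (δ v x + δ v y) ≡ mult v λs + (δ v (pred x) + δ v (suc y))
open Move

move-from-pick : (x , rest) ∈ picks λs → (∀ v → mult v λs ≡ δ v x + mult v rest) →
                 b ∈ bumpOne rest ++ [ 1 ∷ rest ] → Grows rest y b →
                 ∃[ ν ] ν ∈ allMoves λs × Move λs x y (sortDec ν)
move-from-pick {x} {rest} {λs} {b} {y} picked split b∈ grows =
  shrinkOnto x b , ∈-concatMap⁺ _ (Any.map (λ { refl → moved }) picked) , multiplicities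
  where
  moved : shrinkOnto x b ∈ movesFrom x rest
  moved = subst (shrinkOnto x b ∈_) (map-++ (shrinkOnto x) (bumpOne rest) [ 1 ∷ rest ])
                (∈-map⁺ (shrinkOnto x) b∈)

  multiplicities : Move λs x y (sortDec (shrinkOnto x b))
  multiplicities = move λ {v} v>0 → begin
    mult v (sortDec (shrinkOnto x b)) + (δ v x + δ v y)   ≡⟨ cong (_+ _) (mult-sortDec v (shrinkOnto x b)) ⟩
    mult v (shrinkOnto x b) + (δ v x + δ v y)             ≡⟨ cong (_+ _) (mult-shrinkOnto v>0 x b) ⟩
    (δ v (pred x) + mult v b) + (δ v x + δ v y)           ≡⟨ interchange (δ v (pred x)) _ _ _ ⟩
    (δ v (pred x) + δ v x) + (mult v b + δ v y)           ≡⟨ cong₂ _+_ (+-comm (δ v (pred x)) _) (grows v>0) ⟩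
    (δ v x + δ v (pred x)) + (mult v rest + δ v (suc y))  ≡⟨ interchange (δ v x) _ _ _ ⟩
    (δ v x + mult v rest) + (δ v (pred x) + δ v (suc y))  ≡⟨ cong (_+ _) (split v) ⟨
    mult v λs + (δ v (pred x) + δ v (suc y))              ∎
    where open ≡-Reasoning

move-to-part : x ∈ λs → y ∈ λs → x ≢ y → ∃[ ν ] ν ∈ allMoves λs × Move λs x y (sortDec ν)
move-to-part x∈ y∈ x≢y with rest , picked , split ← mult-picks x∈
  with b , bumped , grows ← bumpOne-grows (∈-remainder {rest = rest} split y∈ (≢-sym x≢y)) =
  move-from-pick {rest = rest} picked split (∈-++⁺ˡ bumped) grows

move-to-new-part : x ∈ λs → ∃[ ν ] ν ∈ allMoves λs × Move λs x 0 (sortDec ν)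
move-to-new-part x∈ with rest , picked , split ← mult-picks x∈ =
  move-from-pick {rest = rest} picked split (∈-++⁺ʳ (bumpOne rest) (here refl)) (newPart-grows {rest})

-- For x = y + 1 the move x → y would only swap the sizes of the two parts.
record Effective (x y : ℕ) : Set where
  constructor effective
  field
    source>0        : 1 ≤ x
    source≢target   : x ≢ y
    source≢1+target : x ≢ suc y
open Effective

+-balance-< : ∀ {m n a c} → m + a ≡ n + c → c < a → m < n
+-balance-< {m} {n} {a} {c} eq c<a = +-cancelʳ-< c m n (begin-strict
  m + c  <⟨ +-monoʳ-< m c<a ⟩
  m + a  ≡⟨ eq ⟩
  n + c  ∎)
  where open ≤-Reasoning

+-balance-≤ : ∀ {m n a c} → m + a ≡ n + c → a ≤ c → n ≤ m
+-balance-≤ {m} {n} {a} {c} eq a≤c = +-cancelʳ-≤ a n m (begin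
  n + a  ≤⟨ +-monoʳ-≤ n a≤c ⟩
  n + c  ≡⟨ eq ⟨
  m + a  ∎)
  where open ≤-Reasoning

loses-source : Effective x y → Move λs x y μ → mult x μ < mult x λs
loses-source {zero}  e  _  with () ← source>0 e
loses-source {suc k} {y} e mv = +-balance-< (balance mv (s≤s z≤n)) δ-drop
  where
  δ-drop : δ (suc k) k + δ (suc k) (suc y) < δ (suc k) (suc k) + δ (suc k) y
  δ-drop rewrite δ-≢ {suc k} {k} 1+n≢n | δ-≢ (source≢1+target e)
               | δ-refl (suc k) | δ-≢ (source≢target e) = s≤s z≤n

loses-target : Effective x y → 1 ≤ y → Move λs x y μ → mult y μ < mult y λs
loses-target {zero}  e  _ _  with () ← source>0 e
loses-target {suc k} {y} e y>0 mv = +-balance-< (balance mv y>0) δ-drop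
  where
  δ-drop : δ y k + δ y (suc y) < δ y (suc k) + δ y y
  δ-drop rewrite δ-≢ {y} {k} (λ y≡k → source≢1+target e (cong suc (sym y≡k))) | δ-≢ (≢-sym (1+n≢n {y}))
               | δ-≢ (≢-sym (source≢target e)) | δ-refl y = s≤s z≤n

gains-1+target : Effective x y → Move λs x y μ → mult (suc y) λs < mult (suc y) μ
gains-1+target {x} {y} e mv = +-balance-< (sym (balance mv (s≤s z≤n))) δ-rise
  where
  δ-rise : δ (suc y) x + δ (suc y) y < δ (suc y) (pred x) + δ (suc y) (suc y)
  δ-rise rewrite δ-≢ (≢-sym (source≢1+target e)) | δ-≢ (1+n≢n {y}) | δ-refl (suc y) = m≤n+m 1 _

lost⇒source∨target : ∀ {v} → Move λs x y μ → 1 ≤ v → mult v μ < mult v λs → v ≡ x ⊎ v ≡ y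
lost⇒source∨target {x = x} {y} {v = v} mv v>0 lost with v ≟ x | v ≟ y
... | yes v≡x | _       = inj₁ v≡x
... | no  _   | yes v≡y = inj₂ v≡y
... | no  v≢x | no  v≢y = contradiction (+-balance-≤ (balance mv v>0) no-δ) (<⇒≱ lost)
  where
  no-δ : δ v x + δ v y ≤ δ v (pred x) + δ v (suc y)
  no-δ rewrite δ-≢ v≢x | δ-≢ v≢y = z≤n

gained⇒pred-source∨1+target : ∀ {v} → Move λs x y μ → 1 ≤ v → mult v λs < mult v μ →
                              v ≡ pred x ⊎ v ≡ suc y
gained⇒pred-source∨1+target {x = x} {y} {v = v} mv v>0 gained with v ≟ pred x | v ≟ suc y
... | yes v≡x-1 | _         = inj₁ v≡x-1
... | no  _     | yes v≡y+1 = inj₂ v≡y+1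
... | no  v≢x-1 | no  v≢y+1 = contradiction (+-balance-≤ (sym (balance mv v>0)) no-δ) (<⇒≱ gained)
  where
  no-δ : δ v (pred x) + δ v (suc y) ≤ δ v x + δ v y
  no-δ rewrite δ-≢ v≢x-1 | δ-≢ v≢y+1 = z≤n

positive-target-unique : Effective x y → 1 ≤ y → Move λs x y μ → Move λs x y′ μ → y ≡ y′
positive-target-unique e y>0 mv mv′ with lost⇒source∨target mv′ y>0 (loses-target e y>0 mv)
... | inj₁ y≡x  = contradiction (sym y≡x) (source≢target e)
... | inj₂ y≡y′ = y≡y′

target-unique : Effective x y → Effective x y′ → Move λs x y μ → Move λs x y′ μ → y ≡ y′
target-unique {y = zero}  {y′ = zero}  _ _  _  _   = refl
target-unique {y = suc _}              e _  mv mv′ = positive-target-unique e (s≤s z≤n) mv mv′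
target-unique {y = zero}  {y′ = suc _} _ e′ mv mv′ = sym (positive-target-unique e′ (s≤s z≤n) mv′ mv)

-- Two different sources would have to be swapped (x′ = y, y′ = x), but then
-- the size y + 1 gained by the first move is not gained by the second.
move-injective : Effective x y → Effective x′ y′ → Move λs x y μ → Move λs x′ y′ μ → x ≡ x′ × y ≡ y′
move-injective {x = x} {y = y} {x′ = x′} {y′ = y′} e e′ mv mv′ with x ≟ x′
... | yes refl = refl , target-unique e e′ mv mv′
... | no x≢x′
  with lost⇒source∨target mv′ (source>0 e) (loses-source e mv)
     | lost⇒source∨target mv (source>0 e′) (loses-source e′ mv′)
... | inj₁ x≡x′ | _          = contradiction x≡x′ x≢x′
... | inj₂ _    | inj₁ x′≡x  = contradiction (sym x′≡x) x≢x′
... | inj₂ refl | inj₂ refl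
  with gained⇒pred-source∨1+target mv′ (s≤s z≤n) (gains-1+target e mv)
... | inj₁ y+1≡y-1 = contradiction (sym y+1≡y-1) (<⇒≢ (s≤s pred[n]≤n))
... | inj₂ y+1≡x+1 = contradiction (sym (suc-injective y+1≡x+1)) (source≢target e)

effective-move-neighbour : (∃[ ν ] ν ∈ allMoves λs × Move λs x y (sortDec ν)) → Effective x y →
                           ∃[ μ ] μ ∈ neighbours λs × Move λs x y μ
effective-move-neighbour {λs} {x} (ν , ν∈ , mv) e =
  sortDec ν , ∈-deduplicate⁺ _≟L_ (∈-filter⁺ (λ μ → ¬? (μ ≟L λs)) (∈-map⁺ sortDec ν∈) changed) , mv
  where
  changed : sortDec ν ≢ λs
  changed eq = <⇒≢ (loses-source e mv) (cong (mult x) eq)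

module _ {A B : Set} (_≟B_ : DecidableEquality B) (R : A → B → Set) where

  injective-relation⇒length≤ : ∀ xs ys → Unique xs →
    (∀ {a a′ b} → a ∈ xs → a′ ∈ xs → R a b → R a′ b → a ≡ a′) →
    (∀ {a} → a ∈ xs → ∃[ b ] b ∈ ys × R a b) →
    length xs ≤ length ys
  injective-relation⇒length≤ []       ys _ _ _ = z≤n
  injective-relation⇒length≤ (a ∷ xs) ys (a∉xs ∷ unique) injective total = removing (total (here refl))
    where
    removing : ∃[ b ] b ∈ ys × R a b → suc (length xs) ≤ length ys
    removing (b , b∈ys , Rab) = begin-strict
      length xs   ≤⟨ injective-relation⇒length≤ xs ys′ unique (λ p q → injective (there p) (there q)) total′ ⟩
      length ys′  <⟨ filter-notAll ≢b? ys (Any.map (λ { refl b≢b → b≢b refl }) b∈ys) ⟩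
      length ys   ∎
      where
      open ≤-Reasoning
      ≢b? : ∀ c → Dec (c ≢ b)
      ≢b? c = ¬? (c ≟B b)
      ys′ : List B
      ys′ = filter ≢b? ys
      total′ : ∀ {a′} → a′ ∈ xs → ∃[ c ] c ∈ ys′ × R a′ c
      total′ a′∈ with c , c∈ys , Ra′c ← total (there a′∈) =
        c , ∈-filter⁺ ≢b? c∈ys c≢b , Ra′c
        where
        c≢b : c ≢ b
        c≢b refl = All.lookup a∉xs a′∈ (sym (injective (there a′∈) (here refl) Ra′c Rab))

sizes : List ℕ → List ℕ
sizes = deduplicate _≟_

effective-to-new-part : 1 ≤ y → x ≡ suc y → Effective x 0
effective-to-new-part y>0 refl = effective (s≤s z≤n) (λ ()) (λ y+1≡1 → n>0⇒n≢0 y>0 (suc-injective y+1≡1))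

data Encodes (λs : List ℕ) : ℕ × ℕ → ℕ ⊎ List ℕ → Set where
  diagonal  : Encodes λs (x , x) (inj₁ x)
  toPart    : Effective x y → Move λs x y μ → Encodes λs (x , y) (inj₂ μ)
  toNewPart : x ≡ suc y → Move λs x 0 μ → Encodes λs (x , y) (inj₂ μ)

Encodes-injective : ∀ {c} → 1 ≤ y → 1 ≤ y′ →
                    Encodes λs (x , y) c → Encodes λs (x′ , y′) c → (x , y) ≡ (x′ , y′)
Encodes-injective _ _ diagonal diagonal = refl
Encodes-injective _ _ (toPart e mv) (toPart e′ mv′) with refl , refl ← move-injective e e′ mv mv′ = refl
Encodes-injective y>0 y′>0 (toPart e mv) (toNewPart x′≡1+y′ mv′)
  with refl , y≡0 ← move-injective e (effective-to-new-part y′>0 x′≡1+y′) mv mv′ =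
  contradiction y≡0 (n>0⇒n≢0 y>0)
Encodes-injective y>0 y′>0 (toNewPart x≡1+y mv) (toPart e′ mv′)
  with refl , 0≡y′ ← move-injective (effective-to-new-part y>0 x≡1+y) e′ mv mv′ =
  contradiction (sym 0≡y′) (n>0⇒n≢0 y′>0)
Encodes-injective y>0 y′>0 (toNewPart x≡1+y mv) (toNewPart x′≡1+y′ mv′)
  with refl , _ ← move-injective (effective-to-new-part y>0 x≡1+y) (effective-to-new-part y′>0 x′≡1+y′) mv mv′ =
  cong (_ ,_) (suc-injective (trans (sym x≡1+y) x′≡1+y′))

encode-distinct : 1 ≤ x → 1 ≤ y → x ∈ λs → y ∈ λs → x ≢ y →
                  ∃[ μ ] μ ∈ neighbours λs × Encodes λs (x , y) (inj₂ μ)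
encode-distinct {x} {y} x>0 y>0 x∈ y∈ x≢y with x ≟ suc y
... | yes x≡1+y
  with μ , μ∈ , mv ← effective-move-neighbour (move-to-new-part x∈) (effective-to-new-part y>0 x≡1+y) =
  μ , μ∈ , toNewPart x≡1+y mv
... | no x≢1+y
  with μ , μ∈ , mv ← effective-move-neighbour (move-to-part x∈ y∈ x≢y) (effective x>0 x≢y x≢1+y) =
  μ , μ∈ , toPart (effective x>0 x≢y x≢1+y) mv

encode : All (1 ≤_) λs → x ∈ λs → y ∈ λs →
         ∃[ c ] c ∈ map inj₁ (sizes λs) ++ map inj₂ (neighbours λs) × Encodes λs (x , y) c
encode {x = x} {y} positive x∈ y∈ with x ≟ y
... | yes refl = inj₁ x , ∈-++⁺ˡ (∈-map⁺ inj₁ (∈-deduplicate⁺ _≟_ x∈)) , diagonal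
... | no x≢y
  with μ , μ∈ , enc ← encode-distinct (All.lookup positive x∈) (All.lookup positive y∈) x∈ y∈ x≢y =
  inj₂ μ , ∈-++⁺ʳ _ (∈-map⁺ inj₂ μ∈) , enc

length-cartesianProduct : ∀ {A B : Set} (xs : List A) (ys : List B) →
                          length (cartesianProduct xs ys) ≡ length xs * length ys
length-cartesianProduct []       ys = refl
length-cartesianProduct (x ∷ xs) ys =
  trans (length-++ (map (x ,_) ys)) (cong₂ _+_ (length-map (x ,_) ys) (length-cartesianProduct xs ys))

σ²≤σ+deg : All (1 ≤_) λs → σ λs * σ λs ≤ σ λs + deg λs
σ²≤σ+deg {λs} positive = begin
  σ λs * σ λs                            ≡⟨ length-cartesianProduct (sizes λs) (sizes λs) ⟨
  length pairs                           ≤⟨ injective-relation⇒length≤ (Sum.≡-dec _≟_ _≟L_) (Encodes λs) pairs codes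
                                              (cartesianProduct⁺ (deduplicate-! λs) (deduplicate-! λs))
                                              injective total ⟩
  length codes                           ≡⟨ length-++ (map inj₁ (sizes λs)) ⟩
  length (map inj₁ (sizes λs)) + length (map inj₂ (neighbours λs))
                                         ≡⟨ cong₂ _+_ (length-map inj₁ (sizes λs)) (length-map inj₂ (neighbours λs)) ⟩
  σ λs + deg λs                          ∎
  where
  open ≤-Reasoning
  pairs : List (ℕ × ℕ)
  pairs = cartesianProduct (sizes λs) (sizes λs)
  codes : List (ℕ ⊎ List ℕ)
  codes = map inj₁ (sizes λs) ++ map inj₂ (neighbours λs)

  parts : ∀ {x y} → (x , y) ∈ pairs → x ∈ λs × y ∈ λs
  parts p∈ with x∈ , y∈ ← ∈-cartesianProduct⁻ (sizes λs) (sizes λs) p∈ =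
    ∈-deduplicate⁻ _≟_ λs x∈ , ∈-deduplicate⁻ _≟_ λs y∈

  injective : ∀ {p p′ c} → p ∈ pairs → p′ ∈ pairs → Encodes λs p c → Encodes λs p′ c → p ≡ p′
  injective {_ , _} {_ , _} p∈ p′∈ =
    Encodes-injective (All.lookup positive (proj₂ (parts p∈))) (All.lookup positive (proj₂ (parts p′∈)))

  total : ∀ {p} → p ∈ pairs → ∃[ c ] c ∈ codes × Encodes λs p c
  total {_ , _} p∈ = encode positive (proj₁ (parts p∈)) (proj₂ (parts p∈))

m²≤m+n⇒m[m∸1]≤n : ∀ m n → m * m ≤ m + n → m * (m ∸ 1) ≤ n
m²≤m+n⇒m[m∸1]≤n m n m²≤m+n = begin
  m * (m ∸ 1)    ≡⟨ *-distribˡ-∸ m m 1 ⟩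
  m * m ∸ m * 1  ≡⟨ cong (m * m ∸_) (*-identityʳ m) ⟩
  m * m ∸ m      ≤⟨ m≤n+o⇒m∸n≤o (m * m) m m²≤m+n ⟩
  n              ∎
  where open ≤-Reasoning

corollary4p3 : (n : ℕ) → 1 ≤ n → (λs : List ℕ) → IsPartition n λs →
    deg λs ≥ σ λs * (σ λs ∸ 1)
corollary4p3 _ _ λs partition =
  m²≤m+n⇒m[m∸1]≤n (σ λs) (deg λs) (σ²≤σ+deg (IsPartition.positive partition))
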